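{- Let $0<\lambda<1$, $\lambda'=\frac{1-\lambda}{2}$, and let $\Pi$ be a strongly $\lambda$-extendible property. Let $v$ be a cut vertex of a connected graph $G$, and let $C_1,\dots,C_r$ ($r\ge 2$) be sets of vertices of $G$ such that for all $i\ne j$, $C_i\cap C_j=\{v\}$ and there is no edge between $C_i\setminus\{v\}$ and $C_j\setminus\{v\}$, and $\bigcup_{i=1}^r C_i=V(G)$. For $1\le i\le r$ let $H_i\in\Pi$ be a subgraph of $G[C_i]$ with $pt(G[C_i])+k_i$ edges, and let $H=(V(G),\bigcup_{i=1}^r E(H_i))$. Then $H$ is a subgraph of $G$, $H\in\Pi$, and $|E(H)|\ge pt(G)+\sum_{i=1}^r k_i$.
   Context: Graphs are finite, loopless, without multiple edges, possibly with every edge oriented and/or labelled (connectivity, cut vertices, blocks, cliques refer to the underlying simple graph; subgraphs inherit orientation/labels). A block is a maximal connected subgraph without a cut vertex. For a graph $G$, $pt(G)=\lambda|E(G)|+\lambda'(|V(G)|-1)$. For $S\subseteq V(G)$, $G[S]$ is the induced subgraph, $G\setminus S=G[V(G)\setminus S]$, $\delta(S)$ is the set of edges with exactly one endpoint in $S$. $\Pi$ is strongly $\lambda$-extendible if: every graph whose underlying simple graph is $K_1$ or $K_2$ is in $\Pi$; a graph is in $\Pi$ iff each of its blocks is in $\Pi$; and for every graph $G$, $S\subseteq V(G)$ with $G[S],G\setminus S\in\Pi$ and every $c:E(G)\to\mathbb{R}^+$ there is $F\subseteq\delta(S)$ with $c(F)\ge\lambda c(\delta(S))$ such that deleting the edges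 $\delta(S)\setminus F$ from $G$ yields a graph in $\Pi$. The empty graph is assumed to be in $\Pi$. -}

module Defs where

open import Level using (0ℓ)
open import Data.Nat as ℕ using (ℕ; zero; suc)
open import Data.Fin using (Fin)
import Data.Fin as F
open import Data.Bool using (Bool; false)
open import Data.List using (List; []; _∷_; length; filter; foldr; _++_; map)
open import Data.List.Membership.Propositional using (_∈_; _∉_)
open import Data.List.Membership.DecPropositional ℕ._≟_ using (_∈?_)
open import Data.List.Relation.Unary.Any using (Any)
open import Data.List.Relation.Unary.AllPairs using (AllPairs)
open import Data.List.Relation.Unary.Unique.Propositional using (Unique)
import Data.List.Relation.Binary.Sublist.Propositional as Sublist
open import Data.Product using (_×_; _,_; ∃; ∃₂; Σ)
open import Data.Sum using (_⊎_)
open import Relation.Binary using (Rel; IsTotalOrder)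
open import Relation.Binary.PropositionalEquality using (_≡_; _≢_)
open import Relation.Nullary using (¬_; ¬?)
open import Relation.Nullary.Decidable using (_×-dec_; _⊎-dec_)
open import Algebra.Bundles using (CommutativeRing)
open import Function using (_⇔_)

-- The real numbers, axiomatised as a complete ordered field.
-- (agda-stdlib has no reals; any model of this record is isomorphic
-- to ℝ, and the theorem is stated for every such model.)

record Reals : Set₁ where
  field
    cring : CommutativeRing 0ℓ 0ℓ
  open CommutativeRing cring public
  field
    _≤_          : Rel Carrier 0ℓ
    isTotalOrder : IsTotalOrder _≈_ _≤_
    +-mono-≤     : ∀ {x y} z → x ≤ y → (x + z) ≤ (y + z)
    *-nonneg     : ∀ {x y} → 0# ≤ x → 0# ≤ y → 0# ≤ (x * y)
    0≉1          : ¬ (0# ≈ 1#)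
    inverse      : ∀ x → ¬ (x ≈ 0#) → ∃ λ y → (x * y) ≈ 1#
    complete     : (P : Carrier → Set) → ∃ P →
                   (∃ λ b → ∀ x → P x → x ≤ b) →
                   ∃ λ s → (∀ x → P x → x ≤ s) ×
                           (∀ b → (∀ x → P x → x ≤ b) → s ≤ b)

  _<_ : Carrier → Carrier → Set
  x < y = (x ≤ y) × ¬ (x ≈ y)

  ι : ℕ → Carrier
  ι zero    = 0#
  ι (suc n) = 1# + ι n

  sumL : List Carrier → Carrier
  sumL = foldr _+_ 0#

  sumFin : ∀ {r} → (Fin r → Carrier) → Carrier
  sumFin {zero}  f = 0#
  sumFin {suc r} f = f F.zero + sumFin (λ i → f (F.suc i))

-- Graphs.  Vertices are natural numbers; an edge is a triple
-- (tail , head , label).  If the graph is oriented the edge goes from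
-- tail to head, otherwise it is the unordered pair {tail , head}.

Edge : Set → Set
Edge L = ℕ × ℕ × L

module _ {L : Set} where

  src : Edge L → ℕ
  src (u , _ , _) = u

  tgt : Edge L → ℕ
  tgt (_ , w , _) = w

  lab : Edge L → L
  lab (_ , _ , l) = l

  Joins : Edge L → ℕ → ℕ → Set
  Joins e u w = (src e ≡ u × tgt e ≡ w) ⊎ (src e ≡ w × tgt e ≡ u)

record Graph (L : Set) : Set where
  constructor mkGraph
  field
    oriented : Bool
    V        : List ℕ
    E        : List (Edge L)
open Graph public

module _ {L : Set} where

  -- finite, loopless, no multiple edges
  WF : Graph L → Set
  WF G = Unique (V G)
       × (∀ {e} → e ∈ E G → src e ∈ V G × tgt e ∈ V G × src e ≢ tgt e)
       × AllPairs (λ e e' → ¬ Joins e' (src e) (tgt e)) (E G)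

  Adj : Graph L → ℕ → ℕ → Set
  Adj G u w = Any (λ e → Joins e u w) (E G)

  data Reach (G : Graph L) : ℕ → ℕ → Set where
    here : ∀ {u} → u ∈ V G → Reach G u u
    step : ∀ {u w x} → Adj G u w → Reach G w x → Reach G u x

  Connected : Graph L → Set
  Connected G = ∀ {u w} → u ∈ V G → w ∈ V G → Reach G u w

  _[_] : Graph L → List ℕ → Graph L
  G [ S ] = mkGraph (oriented G) (filter (_∈? S) (V G))
                    (filter (λ e → (src e ∈? S) ×-dec (tgt e ∈? S)) (E G))

  _∖_ : Graph L → List ℕ → Graph L
  G ∖ S = mkGraph (oriented G) (filter (λ x → ¬? (x ∈? S)) (V G))
                  (filter (λ e → ¬? (src e ∈? S) ×-dec ¬? (tgt e ∈? S)) (E G))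

  CutVertex : Graph L → ℕ → Set
  CutVertex G x = x ∈ V G × ∃₂ λ u w → u ∈ V G × w ∈ V G × u ≢ x × w ≢ x
                  × Reach G u w × ¬ Reach (G ∖ (x ∷ [])) u w

  SameEdge : Bool → Edge L → Edge L → Set
  SameEdge o e e' = e ≡ e' ⊎ (o ≡ false × (tgt e , src e , lab e) ≡ e')

  Subgraph : Graph L → Graph L → Set
  Subgraph H G = oriented H ≡ oriented G
               × (∀ {x} → x ∈ V H → x ∈ V G)
               × (∀ {e} → e ∈ E H → Any (SameEdge (oriented G) e) (E G))

  _≅_ : Graph L → Graph L → Set
  G ≅ H = Subgraph G H × Subgraph H G

  NoCutVertex : Graph L → Set
  NoCutVertex B = ∀ x → ¬ CutVertex B x

  IsBlock : Graph L → Graph L → Set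
  IsBlock G B = WF B × Subgraph B G × Connected B × NoCutVertex B
              × (∀ B' → WF B' → Subgraph B' G → Connected B' → NoCutVertex B'
                   → Subgraph B B' → Subgraph B' B)

  -- underlying simple graph is K₁ or K₂ (for well-formed graphs)
  IsK1orK2 : Graph L → Set
  IsK1orK2 G = (length (V G) ≡ 1 × E G ≡ []) ⊎ (length (V G) ≡ 2 × length (E G) ≡ 1)

  δ : Graph L → List ℕ → List (Edge L)
  δ G S = filter (λ e → ((src e ∈? S) ×-dec ¬? (tgt e ∈? S))
                        ⊎-dec (¬? (src e ∈? S) ×-dec (tgt e ∈? S))) (E G)

  keepCross : Graph L → List ℕ → List (Edge L) → Graph L
  keepCross G S F = mkGraph (oriented G) (V G)
    (filter (λ e → ¬? (((src e ∈? S) ×-dec ¬? (tgt e ∈? S))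
                        ⊎-dec (¬? (src e ∈? S) ×-dec (tgt e ∈? S)))) (E G) ++ F)

  unionGraph : ∀ {r} → Graph L → (Fin r → Graph L) → Graph L
  unionGraph {r} G Hs = mkGraph (oriented G) (V G) (go Hs)
    where
      go : ∀ {n} → (Fin n → Graph L) → List (Edge L)
      go {zero}  f = []
      go {suc n} f = E (f F.zero) ++ go (λ i → f (F.suc i))

module _ (R : Reals) where
  open Reals R

  pt : {L : Set} → Carrier → Carrier → Graph L → Carrier
  pt lam lam' G = (lam * ι (length (E G))) + (lam' * (ι (length (V G)) - 1#))

  record StronglyExtendible {L : Set} (lam : Carrier) (Π : Graph L → Set) : Set where
    field
      -- Π is a graph property: independent of the representation
      respects : ∀ G H → G ≅ H → Π G → Π H
      emptyΠ   : ∀ o → Π (mkGraph o [] [])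
      k1k2     : ∀ G → WF G → IsK1orK2 G → Π G
      blocks   : ∀ G → WF G → Π G ⇔ (∀ B → IsBlock G B → Π B)
      extend   : ∀ G → WF G → (S : List ℕ) → (∀ {x} → x ∈ S → x ∈ V G)
               → Π (G [ S ]) → Π (G ∖ S)
               → (c : Edge L → Carrier) → (∀ {e} → e ∈ E G → 0# < c e)
               → ∃ λ F → F Sublist.⊆ δ G S
                       × ((lam * sumL (map c (δ G S))) ≤ sumL (map c F))
                       × Π (keepCross G S F)

-- Hence H is loopless and has no parallel edges, and every block of H with at least
-- two vertices lies inside a single H_j (otherwise v would be a cut vertex of the
-- block), where it is a block of H_j; so H ∈ Π by the block characterisation of Π.
-- For the size, every edge of G lies in exactly one G[C_i], and every vertex other
-- than v in exactly one C_i while v lies in all r of them, so Σ_i pt(G[C_i]) =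
-- λ|E(G)| + λ'(|V(G)| + r - 1 - r) = pt(G) and the bound holds with equality.

module Submission where

open import Defs
open import Data.Nat as ℕ using (ℕ; zero; suc; s≤s; z≤n) renaming (_≤_ to _≤ℕ_)
import Data.Nat.Properties as ℕ
open import Data.Nat.ListAction using () renaming (sum to sumₗ)
open import Data.Fin as Fin using (Fin)
import Data.Fin.Properties as Fin
open import Data.List using (List; []; _∷_; length; filter; map)
import Data.List.Properties as List
open import Data.List.Membership.Propositional using (_∈_; _∉_; find; lose)
open import Data.List.Membership.Propositional.Properties using (∈-filter⁻; ∈-++⁻; ∈-++⁺ˡ; ∈-++⁺ʳ)
open import Data.List.Membership.DecPropositional ℕ._≟_ using (_∈?_)
open import Data.List.Relation.Unary.Any using (Any; here; there)
import Data.List.Relation.Unary.All as All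
open import Data.List.Relation.Unary.AllPairs using (AllPairs; []; _∷_)
import Data.List.Relation.Unary.AllPairs.Properties as AllPairs
open import Data.List.Relation.Unary.Unique.Propositional using (Unique)
open import Data.Maybe using (nothing)
open import Data.Product using (_×_; _,_; proj₁; proj₂; ∃)
open import Data.Sum using (_⊎_; inj₁; inj₂)
open import Data.Empty using (⊥-elim)
open import Function using (_∘_; id; _⇔_)
open import Function.Bundles using (Equivalence)
open import Relation.Nullary using (¬_; ¬?; Dec; yes; no)
open import Relation.Nullary.Decidable using (_×-dec_)
open import Relation.Unary using (Decidable)
open import Relation.Binary.PropositionalEquality as ≡ using (_≡_; _≢_; refl; sym; trans; cong; cong₂; subst)
open import Relation.Binary.Structures using (IsTotalOrder)
import Algebra.Properties.CommutativeMonoid.Sum as MonoidSum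
open import Tactic.RingSolver.Core.AlmostCommutativeRing using (fromCommutativeRing)

module ℕ-Sum = MonoidSum ℕ.+-0-commutativeMonoid
open ℕ-Sum using (sum; sum-cong-≗; ∑-distrib-+)

indicator : ∀ {P : Set} → Dec P → ℕ
indicator (yes _) = 1
indicator (no _)  = 0

length-filter-∷ : ∀ {A : Set} {P : A → Set} (P? : Decidable P) x xs →
  length (filter P? (x ∷ xs)) ≡ indicator (P? x) ℕ.+ length (filter P? xs)
length-filter-∷ P? x xs with P? x
... | yes _ = refl
... | no _  = refl

count : ∀ {r} {Q : Fin r → Set} → (∀ i → Dec (Q i)) → ℕ
count Q? = sum (λ i → indicator (Q? i))

count-none : ∀ {r} {Q : Fin r → Set} (Q? : ∀ i → Dec (Q i)) → (∀ i → ¬ Q i) → count Q? ≡ 0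
count-none {zero}  Q? none = refl
count-none {suc r} Q? none with Q? Fin.zero
... | yes q = ⊥-elim (none Fin.zero q)
... | no _  = count-none (Q? ∘ Fin.suc) (none ∘ Fin.suc)

count-all : ∀ {r} {Q : Fin r → Set} (Q? : ∀ i → Dec (Q i)) → (∀ i → Q i) → count Q? ≡ r
count-all {zero}  Q? all = refl
count-all {suc r} Q? all with Q? Fin.zero
... | yes _ = cong suc (count-all (Q? ∘ Fin.suc) (all ∘ Fin.suc))
... | no ¬q = ⊥-elim (¬q (all Fin.zero))

count-unique : ∀ {r} {Q : Fin r → Set} (Q? : ∀ i → Dec (Q i)) i → Q i → (∀ j → Q j → j ≡ i) → count Q? ≡ 1
count-unique {suc r} Q? Fin.zero q unique with Q? Fin.zero
... | yes _ = cong suc (count-none (Q? ∘ Fin.suc) (λ j q → Fin.0≢1+n (sym (unique (Fin.suc j) q))))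
... | no ¬q = ⊥-elim (¬q q)
count-unique {suc r} Q? (Fin.suc i) q unique with Q? Fin.zero
... | yes q₀ = ⊥-elim (Fin.0≢1+n (unique Fin.zero q₀))
... | no _   = count-unique (Q? ∘ Fin.suc) i q (λ j q → Fin.suc-injective (unique (Fin.suc j) q))

module _ {A : Set} {r} {P : Fin r → A → Set} (P? : ∀ i → Decidable (P i)) where

  multiplicity : A → ℕ
  multiplicity x = count (λ i → P? i x)

  ∑-length-filter : ∀ xs → sum (λ i → length (filter (P? i) xs)) ≡ sumₗ (map multiplicity xs)
  ∑-length-filter []       = ℕ-Sum.sum-replicate-zero r
  ∑-length-filter (x ∷ xs) = begin
    sum (λ i → length (filter (P? i) (x ∷ xs)))
      ≡⟨ sum-cong-≗ (λ i → length-filter-∷ (P? i) x xs) ⟩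
    sum (λ i → indicator (P? i x) ℕ.+ length (filter (P? i) xs))
      ≡⟨ ∑-distrib-+ (λ i → indicator (P? i x)) (λ i → length (filter (P? i) xs)) ⟩
    multiplicity x ℕ.+ sum (λ i → length (filter (P? i) xs))
      ≡⟨ cong (multiplicity x ℕ.+_) (∑-length-filter xs) ⟩
    sumₗ (map multiplicity (x ∷ xs)) ∎
    where open ≡.≡-Reasoning

module _ {A : Set} (f : A → ℕ) where

  sum-map-≡1 : ∀ xs → (∀ {x} → x ∈ xs → f x ≡ 1) → sumₗ (map f xs) ≡ length xs
  sum-map-≡1 []       _   = refl
  sum-map-≡1 (x ∷ xs) one = cong₂ ℕ._+_ (one (here refl)) (sum-map-≡1 xs (one ∘ there))

  sum-map-≡1-except : ∀ {v} xs → Unique xs → v ∈ xs → (∀ {x} → x ∈ xs → x ≢ v → f x ≡ 1) →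
    sumₗ (map f xs) ℕ.+ 1 ≡ length xs ℕ.+ f v
  sum-map-≡1-except (x ∷ xs) (x∉xs ∷ _) (here refl) one
    rewrite sum-map-≡1 xs (λ y∈xs → one (there y∈xs) (All.lookup x∉xs y∈xs ∘ sym))
    = trans (ℕ.+-comm (f x ℕ.+ length xs) 1) (cong suc (ℕ.+-comm (f x) (length xs)))
  sum-map-≡1-except (x ∷ xs) (x∉xs ∷ unique) (there v∈xs) one
    rewrite one (here refl) (All.lookup x∉xs v∈xs)
    = cong suc (sum-map-≡1-except xs unique v∈xs (one ∘ there))

module _ {L : Set} where

  SameEdge-sym : ∀ {o} {e e' : Edge L} → SameEdge o e e' → SameEdge o e' e
  SameEdge-sym (inj₁ refl)       = inj₁ refl
  SameEdge-sym (inj₂ (o , refl)) = inj₂ (o , refl)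

  SameEdge-trans : ∀ {o} {e e' e'' : Edge L} → SameEdge o e e' → SameEdge o e' e'' → SameEdge o e e''
  SameEdge-trans (inj₁ refl)            q                 = q
  SameEdge-trans (inj₂ p)               (inj₁ refl)       = inj₂ p
  SameEdge-trans (inj₂ (_ , refl))      (inj₂ (_ , refl)) = inj₁ refl

  Subgraph-trans : {A B C : Graph L} → Subgraph A B → Subgraph B C → Subgraph A C
  Subgraph-trans {A} {B} {C} (oAB , vAB , eAB) (oBC , vBC , eBC) = trans oAB oBC , vBC ∘ vAB , edge
    where
      edge : ∀ {e} → e ∈ E A → Any (SameEdge (oriented C) e) (E C)
      edge e∈A with find (eAB e∈A)
      ... | e' , e'∈B , e≈e' with find (eBC e'∈B)
      ... | e'' , e''∈C , e'≈e'' = lose e''∈C (SameEdge-trans (subst (λ o → SameEdge o _ e') oBC e≈e') e'≈e'')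

  Inside : List ℕ → Edge L → Set
  Inside S e = src e ∈ S × tgt e ∈ S

  Endpoint : Edge L → ℕ → Set
  Endpoint e y = src e ≡ y ⊎ tgt e ≡ y

  SameEdge-Inside : ∀ {o} {e e' : Edge L} {S} → SameEdge o e e' → Inside S e' → Inside S e
  SameEdge-Inside (inj₁ refl)       in' = in'
  SameEdge-Inside (inj₂ (_ , refl)) (s , t) = t , s

  SameEdge-Endpoint : ∀ {o} {e e' : Edge L} {y} → SameEdge o e e' → Endpoint e y → Endpoint e' y
  SameEdge-Endpoint (inj₁ refl)       p        = p
  SameEdge-Endpoint (inj₂ (_ , refl)) (inj₁ p) = inj₂ p
  SameEdge-Endpoint (inj₂ (_ , refl)) (inj₂ p) = inj₁ p

  Joins-Endpoint : ∀ {e : Edge L} {a w} → Joins e a w → Endpoint e a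
  Joins-Endpoint (inj₁ (p , _)) = inj₁ p
  Joins-Endpoint (inj₂ (_ , p)) = inj₂ p

  Joins-all : ∀ {P : ℕ → Set} {e : Edge L} {a w} → Joins e a w → P (src e) → P (tgt e) → P a × P w
  Joins-all (inj₁ (refl , refl)) s t = s , t
  Joins-all (inj₂ (refl , refl)) s t = t , s

  Endpoint-all : ∀ {P : ℕ → Set} {e : Edge L} {y} → Endpoint e y → P (src e) → P (tgt e) → P y
  Endpoint-all (inj₁ refl) s _ = s
  Endpoint-all (inj₂ refl) _ t = t

  WF-loopless : ∀ {G : Graph L} → WF G → ∀ {e} → e ∈ E G → src e ≢ tgt e
  WF-loopless (_ , ends , _) e∈ = proj₂ (proj₂ (ends e∈))

  WF-endpoint : ∀ {G : Graph L} → WF G → ∀ {e y} → e ∈ E G → Endpoint e y → y ∈ V G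
  WF-endpoint (_ , ends , _) {e} e∈ y-end = Endpoint-all {e = e} y-end (proj₁ (ends e∈)) (proj₁ (proj₂ (ends e∈)))

  Inside-endpoint : ∀ {S} {e : Edge L} {y} → Inside S e → Endpoint e y → y ∈ S
  Inside-endpoint {e = e} (s , t) y-end = Endpoint-all {e = e} y-end s t

  Reach-first-edge : ∀ {B : Graph L} {a b} → Reach B a b → a ≢ b → ∃ λ e → e ∈ E B × Endpoint e a
  Reach-first-edge (here _)     a≢b = ⊥-elim (a≢b refl)
  Reach-first-edge (step adj _) _   with find adj
  ... | e , e∈ , joins = e , e∈ , Joins-Endpoint {e = e} joins

  incident-edge : ∀ {B : Graph L} → Connected B → ∀ {u w} → u ∈ V B → w ∈ V B → u ≢ w →
    ∀ {y} → y ∈ V B → ∃ λ e → e ∈ E B × Endpoint e y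
  incident-edge con {u} u∈ w∈ u≢w {y} y∈ with y ℕ.≟ u
  ... | yes refl = Reach-first-edge (con y∈ w∈) u≢w
  ... | no y≢u   = Reach-first-edge (con y∈ u∈) y≢u

  induced-vertex : ∀ {G : Graph L} {S x} → x ∈ V (G [ S ]) → x ∈ V G
  induced-vertex {G} {S} = proj₁ ∘ ∈-filter⁻ (_∈? S) {xs = V G}

  induced-edge : ∀ {G : Graph L} {S e} → e ∈ E (G [ S ]) → e ∈ E G × Inside S e
  induced-edge {G} {S} = ∈-filter⁻ (λ e → (src e ∈? S) ×-dec (tgt e ∈? S)) {xs = E G}

  deleted-edge : ∀ {G : Graph L} {S e} → e ∈ E (G ∖ S) → e ∈ E G × src e ∉ S × tgt e ∉ S
  deleted-edge {G} {S} = ∈-filter⁻ (λ e → ¬? (src e ∈? S) ×-dec ¬? (tgt e ∈? S)) {xs = E G}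

  induced-⊆ : ∀ {G : Graph L} {S} → Subgraph (G [ S ]) G
  induced-⊆ {G} {S} = refl , induced-vertex {G} {S} , λ e∈ → lose (proj₁ (induced-edge {G} {S} e∈)) (inj₁ refl)

  ⊆-induced-Inside : ∀ {H G : Graph L} {S e} → Subgraph H (G [ S ]) → e ∈ E H → Inside S e
  ⊆-induced-Inside {G = G} {S} (_ , _ , edges) e∈H with find (edges e∈H)
  ... | e' , e'∈ , e≈e' = SameEdge-Inside e≈e' (proj₂ (induced-edge {G} {S} e'∈))

  module _ (G : Graph L) where

    ∈-unionE⁻ : ∀ {r} (Hs : Fin r → Graph L) {e} → e ∈ E (unionGraph G Hs) → ∃ λ i → e ∈ E (Hs i)
    ∈-unionE⁻ {suc r} Hs e∈ with ∈-++⁻ (E (Hs Fin.zero)) e∈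
    ... | inj₁ e∈H₀ = Fin.zero , e∈H₀
    ... | inj₂ e∈Hs with ∈-unionE⁻ (Hs ∘ Fin.suc) e∈Hs
    ... | i , e∈Hᵢ = Fin.suc i , e∈Hᵢ

    ∈-unionE⁺ : ∀ {r} (Hs : Fin r → Graph L) i {e} → e ∈ E (Hs i) → e ∈ E (unionGraph G Hs)
    ∈-unionE⁺ {suc r} Hs Fin.zero    e∈ = ∈-++⁺ˡ e∈
    ∈-unionE⁺ {suc r} Hs (Fin.suc i) e∈ = ∈-++⁺ʳ (E (Hs Fin.zero)) (∈-unionE⁺ (Hs ∘ Fin.suc) i e∈)

    length-unionE : ∀ {r} (Hs : Fin r → Graph L) →
      length (E (unionGraph G Hs)) ≡ sum (λ i → length (E (Hs i)))
    length-unionE {zero}  Hs = refl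
    length-unionE {suc r} Hs = trans (List.length-++ (E (Hs Fin.zero))) (cong (length (E (Hs Fin.zero)) ℕ.+_) (length-unionE (Hs ∘ Fin.suc)))

    ⊆-unionGraph : ∀ {r} (Hs : Fin r → Graph L) i → Subgraph (Hs i) G → Subgraph (Hs i) (unionGraph G Hs)
    ⊆-unionGraph Hs i (o , vs , _) = o , vs , λ e∈ → lose (∈-unionE⁺ Hs i e∈) (inj₁ refl)

    unionGraph-⊆ : ∀ {r} (Hs : Fin r → Graph L) → (∀ i → Subgraph (Hs i) G) → Subgraph (unionGraph G Hs) G
    unionGraph-⊆ Hs Hs⊆G = refl , id , edges
      where
        edges : ∀ {e} → e ∈ E (unionGraph G Hs) → Any (SameEdge (oriented G) e) (E G)
        edges e∈ with ∈-unionE⁻ Hs e∈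
        ... | i , e∈Hᵢ = proj₂ (proj₂ (Hs⊆G i)) e∈Hᵢ

    AllPairs-unionE : ∀ {r} (Hs : Fin r → Graph L) {R : Edge L → Edge L → Set} →
      (∀ i → AllPairs R (E (Hs i))) →
      (∀ {i j} → i ≢ j → ∀ {e e'} → e ∈ E (Hs i) → e' ∈ E (Hs j) → R e e') →
      AllPairs R (E (unionGraph G Hs))
    AllPairs-unionE {zero}  Hs within across = []
    AllPairs-unionE {suc r} Hs {R} within across =
      AllPairs.++⁺ (within Fin.zero)
                   (AllPairs-unionE (Hs ∘ Fin.suc) (within ∘ Fin.suc) (λ i≢j → across (i≢j ∘ Fin.suc-injective)))
                   (All.tabulate λ e∈H₀ → All.tabulate λ e'∈ → across₀ e∈H₀ e'∈)
      where
        across₀ : ∀ {e e'} → e ∈ E (Hs Fin.zero) → e' ∈ E (unionGraph G (Hs ∘ Fin.suc)) → R e e'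
        across₀ e∈ e'∈ with ∈-unionE⁻ (Hs ∘ Fin.suc) e'∈
        ... | j , e'∈Hⱼ = across (λ ()) e∈ e'∈Hⱼ

module Wedge {L : Set} (v : ℕ) {r} (C : Fin r → List ℕ)
  (meet : ∀ {i j x} → i ≢ j → x ∈ C i → x ∈ C j → x ≡ v) where

  part-unique : ∀ {i j x} → x ∈ C i → x ∈ C j → x ≢ v → i ≡ j
  part-unique {i} {j} x∈i x∈j x≢v with i Fin.≟ j
  ... | yes i≡j = i≡j
  ... | no  i≢j = ⊥-elim (x≢v (meet i≢j x∈i x∈j))

  Inside-unique : ∀ {i j} {e : Edge L} → src e ≢ tgt e → Inside (C i) e → Inside (C j) e → i ≡ j
  Inside-unique {i} {j} loopless (si , ti) (sj , tj) with i Fin.≟ j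
  ... | yes i≡j = i≡j
  ... | no  i≢j = ⊥-elim (loopless (trans (meet i≢j si sj) (sym (meet i≢j ti tj))))

  endpoint-≢v : ∀ (e : Edge L) → src e ≢ tgt e → ∃ λ y → Endpoint e y × y ≢ v
  endpoint-≢v e loopless with src e ℕ.≟ v
  ... | yes refl = tgt e , inj₂ refl , loopless ∘ sym
  ... | no  s≢v  = src e , inj₁ refl , s≢v

  module _ (B : Graph L) (endpoint∈B : ∀ {e y} → e ∈ E B → Endpoint e y → y ∈ V B)
           (covered : ∀ {e} → e ∈ E B → ∃ λ j → Inside (C j) e) where

    Reach-∖v-stays : ∀ {i a b} → Reach (B ∖ (v ∷ [])) a b → a ∈ C i → a ≢ v → b ∈ C i
    Reach-∖v-stays (here _) a∈ _ = a∈
    Reach-∖v-stays (step adj rest) a∈ a≢v with find adj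
    ... | e , e∈ , joins with deleted-edge {G = B} {S = v ∷ []} e∈
    ... | e∈B , s∉ , t∉ with covered e∈B
    ... | j , inside with Joins-all {e = e} joins (proj₁ inside) (proj₂ inside) | Joins-all {P = _∉ v ∷ []} {e = e} joins s∉ t∉
    ... | a∈j , w∈j | _ , w∉ with part-unique a∈ a∈j a≢v
    ... | refl = Reach-∖v-stays rest w∈j (w∉ ∘ here)

    Reach-leaving-part : ∀ {i a b} → Reach B a b → a ∈ C i → b ∉ C i → v ∈ V B
    Reach-leaving-part (here _) a∈ b∉ = ⊥-elim (b∉ a∈)
    Reach-leaving-part {a = a} (step adj rest) a∈ b∉ with find adj
    ... | e , e∈ , joins with covered e∈ | a ℕ.≟ v
    ... | _ , _ | yes refl = endpoint∈B e∈ (Joins-Endpoint {e = e} joins)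
    ... | j , inside | no a≢v with Joins-all {e = e} joins (proj₁ inside) (proj₂ inside)
    ... | a∈j , w∈j with part-unique a∈ a∈j a≢v
    ... | refl = Reach-leaving-part rest w∈j b∉

    within-one-part : Connected B → NoCutVertex B →
      ∀ {i x y} → x ∈ V B → x ∈ C i → x ≢ v → y ∈ V B → y ≢ v → y ∈ C i
    within-one-part con no-cut {i} {x} {y} x∈B x∈ x≢v y∈B y≢v with y ∈? C i
    ... | yes y∈ = y∈
    ... | no  y∉ = ⊥-elim (no-cut v (Reach-leaving-part (con x∈B y∈B) x∈ y∉ , x , y , x∈B , y∈B , x≢v , y≢v ,
                                     con x∈B y∈B , λ path → y∉ (Reach-∖v-stays path x∈ x≢v)))

  module Parts (G : Graph L) (Hs : Fin r → Graph L) (wfHs : ∀ i → WF (Hs i))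
           (inside : ∀ i {e} → e ∈ E (Hs i) → Inside (C i) e)
           (Hs⊆G : ∀ i → Subgraph (Hs i) G) where

    Hs⊆H : ∀ i → Subgraph (Hs i) (unionGraph G Hs)
    Hs⊆H i = ⊆-unionGraph G Hs i (Hs⊆G i)

    WF-unionGraph : Unique (V G) → WF (unionGraph G Hs)
    WF-unionGraph unique = unique , ends , AllPairs-unionE G Hs (λ i → proj₂ (proj₂ (wfHs i))) across
      where
        ends : ∀ {e} → e ∈ E (unionGraph G Hs) → src e ∈ V G × tgt e ∈ V G × src e ≢ tgt e
        ends e∈ with ∈-unionE⁻ G Hs e∈
        ... | i , e∈Hᵢ with proj₁ (proj₂ (wfHs i)) e∈Hᵢ
        ... | s∈ , t∈ , loopless = proj₁ (proj₂ (Hs⊆G i)) s∈ , proj₁ (proj₂ (Hs⊆G i)) t∈ , loopless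
        across : ∀ {i j} → i ≢ j → ∀ {e e'} → e ∈ E (Hs i) → e' ∈ E (Hs j) → ¬ Joins e' (src e) (tgt e)
        across {i} {j} i≢j {e} {e'} e∈ e'∈ joins =
          i≢j (Inside-unique {e = e} (WF-loopless {G = Hs i} (wfHs i) e∈) (inside i e∈)
                             (Joins-all {e = e'} joins (proj₁ (inside j e'∈)) (proj₂ (inside j e'∈))))

    endpoint∈C : ∀ i {e y} → e ∈ E (Hs i) → Endpoint e y → y ∈ C i
    endpoint∈C i {e} e∈ = Inside-endpoint {e = e} (inside i e∈)

    edge-origin : ∀ {B} → Subgraph B (unionGraph G Hs) → ∀ {e} → e ∈ E B →
      ∃ λ j → ∃ λ e' → e' ∈ E (Hs j) × SameEdge (oriented G) e e'
    edge-origin (_ , _ , edges) e∈ with find (edges e∈)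
    ... | e' , e'∈H , e≈e' with ∈-unionE⁻ G Hs e'∈H
    ... | j , e'∈Hⱼ = j , e' , e'∈Hⱼ , e≈e'

    module InBlock {B u w} (isB : IsBlock (unionGraph G Hs) B) (u∈ : u ∈ V B) (w∈ : w ∈ V B) (u≢w : u ≢ w) where

      wfB : WF B
      wfB = proj₁ isB

      B⊆H : Subgraph B (unionGraph G Hs)
      B⊆H = proj₁ (proj₂ isB)

      con : Connected B
      con = proj₁ (proj₂ (proj₂ isB))

      no-cut : NoCutVertex B
      no-cut = proj₁ (proj₂ (proj₂ (proj₂ isB)))

      endpoint∈B : ∀ {e y} → e ∈ E B → Endpoint e y → y ∈ V B
      endpoint∈B = WF-endpoint {G = B} wfB

      covered : ∀ {e} → e ∈ E B → ∃ λ j → Inside (C j) e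
      covered e∈ with edge-origin B⊆H e∈
      ... | j , e' , e'∈ , e≈e' = j , SameEdge-Inside e≈e' (inside j e'∈)

      some-vertex-≢v : ∃ λ x → ∃ λ j → x ∈ V B × x ∈ C j × x ≢ v
      some-vertex-≢v with incident-edge con u∈ w∈ u≢w u∈
      ... | e , e∈ , _ with endpoint-≢v e (WF-loopless {G = B} wfB e∈) | covered e∈
      ... | x , x-end , x≢v | j , e-inside = x , j , endpoint∈B e∈ x-end , Inside-endpoint {e = e} e-inside x-end , x≢v

      module _ {j x} (x∈B : x ∈ V B) (x∈j : x ∈ C j) (x≢v : x ≢ v) where

        edge-in-part : ∀ {e} → e ∈ E B → ∃ λ e' → e' ∈ E (Hs j) × SameEdge (oriented G) e e'
        edge-in-part {e} e∈ with edge-origin B⊆H e∈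
        ... | j' , e' , e'∈ , e≈e' with endpoint-≢v e' (WF-loopless {G = Hs j'} (wfHs j') e'∈)
        ... | y , y-end , y≢v
          with part-unique (within-one-part B endpoint∈B covered con no-cut x∈B x∈j x≢v
                              (endpoint∈B e∈ (SameEdge-Endpoint (SameEdge-sym e≈e') y-end)) y≢v)
                           (endpoint∈C j' e'∈ y-end) y≢v
        ... | refl = e' , e'∈ , e≈e'

        vertex-in-part : ∀ {y} → y ∈ V B → y ∈ V (Hs j)
        vertex-in-part y∈ with incident-edge con u∈ w∈ u≢w y∈
        ... | e , e∈ , y-end with edge-in-part e∈
        ... | e' , e'∈ , e≈e' = WF-endpoint {G = Hs j} (wfHs j) e'∈ (SameEdge-Endpoint e≈e' y-end)

        B⊆Hⱼ : Subgraph B (Hs j)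
        B⊆Hⱼ = trans (proj₁ B⊆H) (sym (proj₁ (Hs⊆H j))) , vertex-in-part , edges
          where
            edges : ∀ {e} → e ∈ E B → Any (SameEdge (oriented (Hs j)) e) (E (Hs j))
            edges e∈ with edge-in-part e∈
            ... | e' , e'∈ , e≈e' = lose e'∈ (subst (λ o → SameEdge o _ e') (sym (proj₁ (Hs⊆H j))) e≈e')

        block-of-part : IsBlock (Hs j) B
        block-of-part = wfB , B⊆Hⱼ , con , no-cut ,
          λ B' wfB' B'⊆Hⱼ → proj₂ (proj₂ (proj₂ (proj₂ isB))) B' wfB' (Subgraph-trans B'⊆Hⱼ (Hs⊆H j))

    block-within-part : ∀ {B u w} → IsBlock (unionGraph G Hs) B → u ∈ V B → w ∈ V B → u ≢ w →
      ∃ λ j → IsBlock (Hs j) B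
    block-within-part isB u∈ w∈ u≢w with InBlock.some-vertex-≢v isB u∈ w∈ u≢w
    ... | x , j , x∈B , x∈j , x≢v = j , InBlock.block-of-part isB u∈ w∈ u≢w x∈B x∈j x≢v

    Π-unionGraph : ∀ {R : Reals} {lam : Reals.Carrier R} {Π : Graph L → Set} → StronglyExtendible R lam Π →
      WF (unionGraph G Hs) → (∀ i → Π (Hs i)) → Π (unionGraph G Hs)
    Π-unionGraph {Π = Π} SE wfH ΠHs = Equivalence.from (blocks (unionGraph G Hs) wfH) Π-block
      where
        open StronglyExtendible SE
        Π-block : ∀ B → IsBlock (unionGraph G Hs) B → Π B
        Π-block (mkGraph o [] [])                        _ = emptyΠ o
        Π-block (mkGraph o [] (e ∷ _))                   ((_ , ends , _) , _) with ends (here refl)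
        ... | () , _
        Π-block (mkGraph o (u ∷ []) [])                  (wfB , _) = k1k2 _ wfB (inj₁ (refl , refl))
        Π-block (mkGraph o (u ∷ []) ((s , t , _) ∷ _))   ((_ , ends , _) , _) with ends (here refl)
        ... | here refl , here refl , loop = ⊥-elim (loop refl)
        Π-block B@(mkGraph o (u ∷ w ∷ _) _) isB@(((u∉ ∷ _) , _) , _)
          with block-within-part isB (here refl) (there (here refl)) (All.head u∉)
        ... | j , isBⱼ = Equivalence.to (blocks (Hs j) (wfHs j)) (ΠHs j) B isBⱼ

  module Decomposition (G : Graph L) (wfG : WF G) (v∈G : v ∈ V G) (v∈C : ∀ i → v ∈ C i)
    (separated : ∀ i j → i ≢ j → ∀ x y → x ∈ C i → x ≢ v → y ∈ C j → y ≢ v → ¬ Adj G x y)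
    (cover : ∀ {x} → x ∈ V G → ∃ λ i → x ∈ C i) where

    edge-part : ∀ {e} → e ∈ E G → ∃ λ i → Inside (C i) e
    edge-part {e} e∈ with proj₁ (proj₂ wfG) e∈
    ... | s∈ , t∈ , _ with cover s∈ | cover t∈ | src e ℕ.≟ v | tgt e ℕ.≟ v
    ... | _ , _   | j , t∈j | yes s≡v | _       = j , subst (_∈ C j) (sym s≡v) (v∈C j) , t∈j
    ... | i , s∈i | _       | no _    | yes t≡v = i , s∈i , subst (_∈ C i) (sym t≡v) (v∈C i)
    ... | i , s∈i | j , t∈j | no s≢v  | no t≢v with i Fin.≟ j
    ...   | yes refl = i , s∈i , t∈j
    ...   | no  i≢j  = ⊥-elim (separated i j i≢j _ _ s∈i s≢v t∈j t≢v (lose e∈ (inj₁ (refl , refl))))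

    ∑-induced-edges : sum (λ i → length (E (G [ C i ]))) ≡ length (E G)
    ∑-induced-edges = trans (∑-length-filter inside? (E G)) (sum-map-≡1 (multiplicity inside?) (E G) once)
      where
        inside? : ∀ i → Decidable (Inside (C i))
        inside? i e = (src e ∈? C i) ×-dec (tgt e ∈? C i)
        once : ∀ {e} → e ∈ E G → multiplicity inside? e ≡ 1
        once {e} e∈ with edge-part e∈
        ... | i , in-i = count-unique (λ j → inside? j e) i in-i
                           (λ j in-j → Inside-unique {e = e} (WF-loopless {G = G} wfG e∈) in-j in-i)

    ∑-induced-vertices : sum (λ i → length (V (G [ C i ]))) ℕ.+ 1 ≡ length (V G) ℕ.+ r
    ∑-induced-vertices = begin
      sum (λ i → length (V (G [ C i ]))) ℕ.+ 1
        ≡⟨ cong (ℕ._+ 1) (∑-length-filter member? (V G)) ⟩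
      sumₗ (map (multiplicity member?) (V G)) ℕ.+ 1
        ≡⟨ sum-map-≡1-except (multiplicity member?) (V G) (proj₁ wfG) v∈G once ⟩
      length (V G) ℕ.+ multiplicity member? v
        ≡⟨ cong (length (V G) ℕ.+_) (count-all (λ i → member? i v) v∈C) ⟩
      length (V G) ℕ.+ r ∎
      where
        open ≡.≡-Reasoning
        member? : ∀ i → Decidable (_∈ C i)
        member? i x = x ∈? C i
        once : ∀ {x} → x ∈ V G → x ≢ v → multiplicity member? x ≡ 1
        once {x} x∈ x≢v with cover x∈
        ... | i , x∈i = count-unique (λ j → member? j x) i x∈i (λ j x∈j → part-unique x∈j x∈i x≢v)

module RealSums (R : Reals) where
  open Reals R renaming (refl to ≈-refl; sym to ≈-sym; trans to ≈-trans)
  open import Relation.Binary.Reasoning.Setoid setoid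
  open import Algebra.Definitions.RawMonoid +-rawMonoid using () renaming (_×_ to _·_)
  open import Algebra.Properties.Monoid.Mult +-monoid using (×-homo-+)
  open import Algebra.Properties.Group +-group using (//-rightDividesʳ)
  -- Without a test for zero the solver cannot cancel terms, so every cancellation below is done by hand.
  open import Tactic.RingSolver.NonReflective (fromCommutativeRing cring (λ _ → nothing))

  ι≡·1# : ∀ n → ι n ≡ n · 1#
  ι≡·1# zero    = ≡.refl
  ι≡·1# (suc n) = ≡.cong (1# +_) (ι≡·1# n)

  ι-homo-+ : ∀ m n → ι (m ℕ.+ n) ≈ ι m + ι n
  ι-homo-+ m n rewrite ι≡·1# (m ℕ.+ n) | ι≡·1# m | ι≡·1# n = ×-homo-+ 1# m n

  ι-cancel : ∀ {a b c} → a ℕ.+ 1 ≡ b ℕ.+ c → ι a - ι c ≈ ι b - 1#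
  ι-cancel {a} {b} {c} eq = begin
    ι a - ι c
      ≈⟨ //-rightDividesʳ 1# (ι a - ι c) ⟨
    ((ι a - ι c) + 1#) - 1#
      ≈⟨ +-congʳ (solve 2 (λ x z → ((x ⊕ ⊝ z) ⊕ Κ 1#) ⊜ ((x ⊕ Κ 1#) ⊕ ⊝ z)) ≈-refl (ι a) (ι c)) ⟩
    ((ι a + 1#) - ι c) - 1#
      ≈⟨ +-congʳ (+-congʳ ι[a+1]) ⟩
    ((ι b + ι c) - ι c) - 1#
      ≈⟨ +-congʳ (//-rightDividesʳ (ι c) (ι b)) ⟩
    ι b - 1# ∎
    where
      ι[a+1] : ι a + 1# ≈ ι b + ι c
      ι[a+1] = begin
        ι a + 1#         ≈⟨ +-congˡ (+-identityʳ 1#) ⟨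
        ι a + ι 1        ≈⟨ ι-homo-+ a 1 ⟨
        ι (a ℕ.+ 1)      ≡⟨ ≡.cong ι eq ⟩
        ι (b ℕ.+ c)      ≈⟨ ι-homo-+ b c ⟩
        ι b + ι c        ∎

  module _ (lam lam' : Carrier) where

    ι-∑-affine : ∀ {r} (h e n : Fin r → ℕ) (k : Fin r → Carrier) →
      (∀ i → ι (h i) ≈ ((lam * ι (e i)) + (lam' * (ι (n i) - 1#))) + k i) →
      ι (sum h) ≈ ((lam * ι (sum e)) + (lam' * (ι (sum n) - ι r))) + sumFin k
    ι-∑-affine {zero} h e n k hyp = ≈-sym (begin
      ((lam * 0#) + (lam' * (0# - 0#))) + 0#
        ≈⟨ +-identityʳ _ ⟩
      (lam * 0#) + (lam' * (0# - 0#))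
        ≈⟨ +-cong (zeroʳ lam) (≈-trans (*-congˡ (-‿inverseʳ 0#)) (zeroʳ lam')) ⟩
      0# + 0#
        ≈⟨ +-identityʳ 0# ⟩
      0# ∎)
    ι-∑-affine {suc r} h e n k hyp = begin
      ι (h₀ ℕ.+ ∑h)
        ≈⟨ ι-homo-+ h₀ ∑h ⟩
      ι h₀ + ι ∑h
        ≈⟨ +-cong (hyp Fin.zero) (ι-∑-affine (h ∘ Fin.suc) (e ∘ Fin.suc) (n ∘ Fin.suc) (k ∘ Fin.suc) (hyp ∘ Fin.suc)) ⟩
      (((lam * ι e₀) + (lam' * (ι n₀ - 1#))) + k₀) + (((lam * ι ∑e) + (lam' * (ι ∑n - ι r))) + ∑k)
        ≈⟨ solve 9 (λ a b x y z X Y Z m →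
             (((a ⊗ x ⊕ b ⊗ (y ⊕ ⊝ Κ 1#)) ⊕ z) ⊕ ((a ⊗ X ⊕ b ⊗ (Y ⊕ ⊝ m)) ⊕ Z))
             ⊜ ((a ⊗ (x ⊕ X) ⊕ b ⊗ ((y ⊕ Y) ⊕ ⊝ (Κ 1# ⊕ m))) ⊕ (z ⊕ Z)))
             ≈-refl lam lam' (ι e₀) (ι n₀) k₀ (ι ∑e) (ι ∑n) ∑k (ι r) ⟩
      ((lam * (ι e₀ + ι ∑e)) + (lam' * ((ι n₀ + ι ∑n) - ι (suc r)))) + (k₀ + ∑k)
        ≈⟨ +-congʳ (+-cong (*-congˡ (≈-sym (ι-homo-+ e₀ ∑e))) (*-congˡ (+-congʳ (≈-sym (ι-homo-+ n₀ ∑n))))) ⟩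
      ((lam * ι (e₀ ℕ.+ ∑e)) + (lam' * (ι (n₀ ℕ.+ ∑n) - ι (suc r)))) + (k₀ + ∑k) ∎
      where
        h₀ = h Fin.zero
        e₀ = e Fin.zero
        n₀ = n Fin.zero
        k₀ = k Fin.zero
        ∑h = sum (h ∘ Fin.suc)
        ∑e = sum (e ∘ Fin.suc)
        ∑n = sum (n ∘ Fin.suc)
        ∑k = sumFin (k ∘ Fin.suc)

    ι-∑-edges≈pt : ∀ {L : Set} {r} (G : Graph L) (Gs Hs : Fin r → Graph L) (k : Fin r → Carrier) →
      sum (λ i → length (E (Gs i))) ≡ length (E G) →
      sum (λ i → length (V (Gs i))) ℕ.+ 1 ≡ length (V G) ℕ.+ r →
      (∀ i → ι (length (E (Hs i))) ≈ pt R lam lam' (Gs i) + k i) →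
      ι (sum (λ i → length (E (Hs i)))) ≈ pt R lam lam' G + sumFin k
    ι-∑-edges≈pt {r = r} G Gs Hs k ∑E ∑V size = begin
      ι (sum (λ i → length (E (Hs i))))
        ≈⟨ ι-∑-affine (λ i → length (E (Hs i))) (λ i → length (E (Gs i))) (λ i → length (V (Gs i))) k size ⟩
      ((lam * ι (sum (λ i → length (E (Gs i))))) + (lam' * (ι (sum (λ i → length (V (Gs i)))) - ι r))) + sumFin k
        ≈⟨ +-congʳ (+-cong (*-congˡ (reflexive (≡.cong ι ∑E))) (*-congˡ (ι-cancel {b = length (V G)} {c = r} ∑V))) ⟩
      pt R lam lam' G + sumFin k ∎

module _ {v : ℕ} {r} {C : Fin r → List ℕ} (hC : ∀ i j → i ≢ j → ∀ x → (x ∈ C i × x ∈ C j) ⇔ (x ≡ v)) where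

  ⇔-meet : ∀ {i j x} → i ≢ j → x ∈ C i → x ∈ C j → x ≡ v
  ⇔-meet {i} {j} {x} i≢j x∈i x∈j = Equivalence.to (hC i j i≢j x) (x∈i , x∈j)

  ⇔-center : ∀ {i j} → i ≢ j → v ∈ C i
  ⇔-center {i} {j} i≢j = proj₁ (Equivalence.from (hC i j i≢j v) refl)

another : ∀ {r} (i : Fin (suc (suc r))) → ∃ λ j → i ≢ j
another Fin.zero    = Fin.suc Fin.zero , λ ()
another (Fin.suc _) = Fin.zero , λ ()

mainTheorem3 : (R : Reals) → let open Reals R in
    (L : Set) (lam lam' : Carrier) → 0# < lam → lam < 1# → (lam' + lam') ≈ (1# - lam) →
    (Π : Graph L → Set) → StronglyExtendible R lam Π →
    (G : Graph L) → WF G → Connected G → (v : ℕ) → CutVertex G v →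
    (r : ℕ) → 2 ≤ℕ r → (C : Fin r → List ℕ) →
    (∀ i j → i ≢ j → ∀ x → (x ∈ C i × x ∈ C j) ⇔ (x ≡ v)) →
    (∀ i j → i ≢ j → ∀ x y → x ∈ C i → x ≢ v → y ∈ C j → y ≢ v → ¬ Adj G x y) →
    (∀ x → x ∈ V G ⇔ ∃ (λ i → x ∈ C i)) →
    (Hs : Fin r → Graph L) → (k : Fin r → Carrier) →
    (∀ i → WF (Hs i) × Subgraph (Hs i) (G [ C i ]) × Π (Hs i)
           × (ι (length (E (Hs i))) ≈ (pt R lam lam' (G [ C i ]) + k i))) →
    WF (unionGraph G Hs) × Subgraph (unionGraph G Hs) G × Π (unionGraph G Hs)
      × ((pt R lam lam' G + sumFin k) ≤ ι (length (E (unionGraph G Hs))))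
mainTheorem3 R L lam lam' _ _ _ Π SE G wfG _ v cut (suc (suc r)) (s≤s (s≤s z≤n)) C hC separated hV Hs k hH =
  wfH , unionGraph-⊆ G Hs Hs⊆G , Π-unionGraph SE wfH (proj₁ ∘ proj₂ ∘ proj₂ ∘ hH) ,
  IsTotalOrder.reflexive isTotalOrder (≈-sym size)
  where
    open Reals R hiding (refl) renaming (sym to ≈-sym; trans to ≈-trans)
    open RealSums R
    open Wedge v C (⇔-meet hC)
    Hs⊆G : ∀ i → Subgraph (Hs i) G
    Hs⊆G i = Subgraph-trans (proj₁ (proj₂ (hH i))) (induced-⊆ {G = G} {C i})
    open Parts G Hs (proj₁ ∘ hH) (λ i → ⊆-induced-Inside {G = G} (proj₁ (proj₂ (hH i)))) Hs⊆G
    open Decomposition G wfG (proj₁ cut) (λ i → ⇔-center hC (proj₂ (another i))) separated (Equivalence.to (hV _))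
    wfH : WF (unionGraph G Hs)
    wfH = WF-unionGraph (proj₁ wfG)
    size : ι (length (E (unionGraph G Hs))) ≈ pt R lam lam' G + sumFin k
    size = ≈-trans (reflexive (cong ι (length-unionE G Hs)))
                   (ι-∑-edges≈pt lam lam' G (λ i → G [ C i ]) Hs k ∑-induced-edges ∑-induced-vertices (proj₂ ∘ proj₂ ∘ proj₂ ∘ hH))
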